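{- Let $G$ and $H$ be vertex-disjoint balanced graphs, let $v\in V(G)$ and $w\in V(H)$, and let $(G\cup H)/vw$ be obtained from $G\cup H$ by identifying $v$ and $w$. Then $\mathcal{K}(G\cup H)\simeq\mathcal{K}((G\cup H)/vw)\oplus\mathbf{Z}$ and $K(G\cup H)\simeq K((G\cup H)/vw)$.
   Context: A graph is a finite directed multigraph. For $G=(V,E)$, $A$ is the $V\times V$ matrix with $A_{vw}$ the number of directed edges from $v$ to $w$, $\Delta$ is diagonal with $\Delta_{vv}=\sum_wA_{vw}$, $Q=\Delta-A$, $\dagger$ denotes transpose, $\mathcal{K}(G)=\mathbf{Z}^V/Q^{\dagger}\mathbf{Z}^V$, and $K(G)$ is its torsion subgroup. A graph is balanced if it is strongly connected and each vertex has indegree equal to its outdegree. -}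

module Defs where

open import Data.Nat as ℕ using (ℕ; zero; suc; pred)
open import Data.Integer using (ℤ; +_; 0ℤ; -1ℤ; -_; _-_; _+_; _*_)
open import Data.Integer.Properties using (pos-*)
open import Data.Integer.Tactic.RingSolver using (solve-∀)
open import Data.Fin using (Fin; zero; suc; splitAt; _↑ˡ_; _↑ʳ_; punchOut; _≟_)
open import Data.Sum using (_⊎_; inj₁; inj₂)
open import Data.Maybe using (Maybe; just; nothing)
open import Data.Product using (Σ; ∃; _,_; _×_; proj₁; proj₂)
open import Data.Bool using (Bool; true; false; _∧_; if_then_else_)
open import Relation.Nullary using (yes; no)
open import Relation.Nullary.Decidable using (⌊_⌋)
open import Relation.Binary.PropositionalEquality
open import Level using (0ℓ)
open import Algebra.Bundles.Raw using (RawGroup)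
open import Algebra.Construct.DirectProduct using (rawGroup)
open import Data.Integer.Base using (+-0-rawGroup)

-- Finite directed multigraphs: vertex set Fin n, A v w = number of
-- directed edges from v to w (loops allowed).

record Graph : Set where
  field
    n : ℕ
    A : Fin n → Fin n → ℕ
open Graph public

sumℕ : ∀ {k} → (Fin k → ℕ) → ℕ
sumℕ {zero}  f = 0
sumℕ {suc k} f = f zero ℕ.+ sumℕ (λ i → f (suc i))

sumℤ : ∀ {k} → (Fin k → ℤ) → ℤ
sumℤ {zero}  f = 0ℤ
sumℤ {suc k} f = f zero + sumℤ (λ i → f (suc i))

outdeg indeg : (G : Graph) → Fin (n G) → ℕ
outdeg G v = sumℕ (λ w → A G v w)
indeg  G v = sumℕ (λ u → A G u v)

data Reach (G : Graph) : Fin (n G) → Fin (n G) → Set where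
  here : ∀ {u} → Reach G u u
  step : ∀ {u w v} → 0 ℕ.< A G u w → Reach G w v → Reach G u v

StronglyConnected : Graph → Set
StronglyConnected G = ∀ u v → Reach G u v

Balanced : Graph → Set
Balanced G = StronglyConnected G × (∀ v → indeg G v ≡ outdeg G v)

-- Laplacian Q = Δ - A and the group 𝒦(G) = ℤ^V / Qᵀ ℤ^V

δ : ∀ {k} → Fin k → Fin k → ℕ → ℕ
δ u v m = if ⌊ u ≟ v ⌋ then m else 0

Lap : (G : Graph) → Fin (n G) → Fin (n G) → ℤ
Lap G u v = + δ u v (outdeg G u) - + A G u v

Qᵀ : (G : Graph) → (Fin (n G) → ℤ) → Fin (n G) → ℤ
Qᵀ G z v = sumℤ (λ u → Lap G u v * z u)

Congruent : (G : Graph) → (Fin (n G) → ℤ) → (Fin (n G) → ℤ) → Set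
Congruent G x y = ∃ λ (z : Fin (n G) → ℤ) → ∀ v → x v - y v ≡ Qᵀ G z v

SandpileGroup : Graph → RawGroup 0ℓ 0ℓ
SandpileGroup G = record
  { Carrier = Fin (n G) → ℤ
  ; _≈_     = λ x y → Congruent G x y
  ; _∙_     = λ x y v → x v + y v
  ; ε       = λ _ → 0ℤ
  ; _⁻¹     = λ x v → - x v
  }

SandpileGroup⊕ℤ : Graph → RawGroup 0ℓ 0ℓ
SandpileGroup⊕ℤ G = rawGroup (SandpileGroup G) +-0-rawGroup

IsTorsion : (G : Graph) → (Fin (n G) → ℤ) → Set
IsTorsion G x = ∃ λ (k : ℕ) → Congruent G (λ v → + suc k * x v) (λ _ → 0ℤ)

private
  sum-lin : ∀ {k} (a b : ℤ) (f g : Fin k → ℤ) →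
            sumℤ (λ u → a * f u + b * g u) ≡ a * sumℤ f + b * sumℤ g
  sum-lin {zero}  a b f g = z a b
    where
    z : ∀ a b → 0ℤ ≡ a * 0ℤ + b * 0ℤ
    z = solve-∀
  sum-lin {suc k} a b f g
    rewrite sum-lin a b (λ i → f (suc i)) (λ i → g (suc i)) =
      lemma a b (f zero) (g zero) (sumℤ (λ i → f (suc i))) (sumℤ (λ i → g (suc i)))
    where
    lemma : ∀ a b x y s t → a * x + b * y + (a * s + b * t) ≡ a * (x + s) + b * (y + t)
    lemma = solve-∀

  Qᵀ-lin : ∀ G (a b : ℤ) (z w : Fin (n G) → ℤ) v →
           Qᵀ G (λ u → a * z u + b * w u) v ≡ a * Qᵀ G z v + b * Qᵀ G w v
  sum-cong : ∀ {k} (f g : Fin k → ℤ) → (∀ i → f i ≡ g i) → sumℤ f ≡ sumℤ g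
  sum-cong {zero}  f g e = refl
  sum-cong {suc k} f g e = cong₂ _+_ (e zero) (sum-cong (λ i → f (suc i)) (λ i → g (suc i)) (λ i → e (suc i)))

  Qᵀ-lin G a b z w v =
    trans (sum-cong _ _ (λ u → lemma (Lap G u v) a b (z u) (w u)))
          (sum-lin a b (λ u → Lap G u v * z u) (λ u → Lap G u v * w u))
    where
    lemma : ∀ q a b x y → q * (a * x + b * y) ≡ a * (q * x) + b * (q * y)
    lemma = solve-∀

torsion-∙ : ∀ G x y → IsTorsion G x → IsTorsion G y → IsTorsion G (λ v → x v + y v)
torsion-∙ G x y (k₁ , z₁ , e₁) (k₂ , z₂ , e₂) =
  (k₂ ℕ.+ k₁ ℕ.* suc k₂) , (λ u → + suc k₂ * z₁ u + + suc k₁ * z₂ u) , λ v →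
    trans (trans (cong (λ c → c * (x v + y v) - 0ℤ) (pos-* (suc k₁) (suc k₂)))
                 (trans (lemma (+ suc k₁) (+ suc k₂) (x v) (y v))
                        (cong₂ (λ p q → + suc k₂ * p + + suc k₁ * q) (e₁ v) (e₂ v))))
          (sym (Qᵀ-lin G (+ suc k₂) (+ suc k₁) z₁ z₂ v))
  where
  lemma : ∀ a b x y → a * b * (x + y) - 0ℤ ≡ b * (a * x - 0ℤ) + a * (b * y - 0ℤ)
  lemma = solve-∀

torsion-ε : ∀ G → IsTorsion G (λ _ → 0ℤ)
torsion-ε G = 0 , (λ _ → 0ℤ) , λ v →
  trans (sym (lemma (Qᵀ G (λ _ → 0ℤ) v))) (sym (Qᵀ-lin G 0ℤ 0ℤ (λ _ → 0ℤ) (λ _ → 0ℤ) v))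
  where
  lemma : ∀ t → 0ℤ * t + 0ℤ * t ≡ 0ℤ
  lemma = solve-∀

torsion-⁻¹ : ∀ G x → IsTorsion G x → IsTorsion G (λ v → - x v)
torsion-⁻¹ G x (k , z , e) = k , (λ u → - z u) , λ v →
  trans (trans (lemma (+ suc k) (x v)) (cong (λ t → -1ℤ * t + 0ℤ * t) (e v)))
        (trans (sym (Qᵀ-lin G -1ℤ 0ℤ z z v)) (sum-cong _ _ (λ u → lemma2 (Lap G u v) (z u))))
  where
  lemma : ∀ c x → c * (- x) - 0ℤ ≡ -1ℤ * (c * x - 0ℤ) + 0ℤ * (c * x - 0ℤ)
  lemma = solve-∀
  lemma2 : ∀ q z → q * (-1ℤ * z + 0ℤ * z) ≡ q * (- z)
  lemma2 = solve-∀

TorsionGroup : Graph → RawGroup 0ℓ 0ℓ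
TorsionGroup G = record
  { Carrier = Σ (Fin (n G) → ℤ) (IsTorsion G)
  ; _≈_     = λ x y → Congruent G (proj₁ x) (proj₁ y)
  ; _∙_     = λ x y → (λ v → proj₁ x v + proj₁ y v) , torsion-∙ G (proj₁ x) (proj₁ y) (proj₂ x) (proj₂ y)
  ; ε       = (λ _ → 0ℤ) , torsion-ε G
  ; _⁻¹     = λ x → (λ v → - proj₁ x v) , torsion-⁻¹ G (proj₁ x) (proj₂ x)
  }

_∪ᴳ_ : Graph → Graph → Graph
G ∪ᴳ H = record { n = n G ℕ.+ n H ; A = λ i j → edges (splitAt (n G) i) (splitAt (n G) j) }
  where
  edges : Fin (n G) ⊎ Fin (n H) → Fin (n G) ⊎ Fin (n H) → ℕ
  edges (inj₁ a) (inj₁ b) = A G a b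
  edges (inj₂ a) (inj₂ b) = A H a b
  edges _        _        = 0

removeAt : ∀ {k} → Fin k → Fin k → Maybe (Fin (pred k))
removeAt {suc k} w j with w ≟ j
... | yes _  = nothing
... | no w≢j = just (punchOut w≢j)

identifyMap : (G H : Graph) → Fin (n G) → Fin (n H) →
              Fin (n G ℕ.+ n H) → Fin (n G ℕ.+ pred (n H))
identifyMap G H v w i with splitAt (n G) i
... | inj₁ a = a ↑ˡ pred (n H)
... | inj₂ b with removeAt w b
...   | nothing = v ↑ˡ pred (n H)
...   | just c  = n G ↑ʳ c

-- (G ∪ H)/vw : every edge x → y of G ∪ H becomes an edge π x → π y
identify : (G H : Graph) → Fin (n G) → Fin (n H) → Graph
identify G H v w = record
  { n = n G ℕ.+ pred (n H)
  ; A = λ a b → sumℕ (λ x → sumℕ (λ y →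
          if ⌊ π x ≟ a ⌋ ∧ ⌊ π y ≟ b ⌋ then A (G ∪ᴳ H) x y else 0))
  }
  where π = identifyMap G H v w

-- Let π : V(G ∪ H) → V((G ∪ H)/vw) be the quotient map and π₊ the pushforward of
-- configurations along it (summing over fibres). The map y ↦ (π₊ y , Σ_{V(G)} y) is a
-- bijection ℤ^V(G ∪ H) → ℤ^V((G ∪ H)/vw) × ℤ. It intertwines the Laplacians on
-- potentials that factor through π: π₊ (Qᵀ (z′ ∘ π)) = Q′ᵀ z′. Every Qᵀ z is of this
-- form: H is Eulerian, so the indicator of V(H) lies in the kernel of Qᵀ, and shifting z
-- on V(H) by z(v) − z(w) makes it constant on the fibres of π. Since the rows of the
-- Laplacian of G sum to zero, Σ_{V(G)} vanishes on the image of Qᵀ. Hence the bijection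
-- carries im Qᵀ onto im Q′ᵀ × 0. Torsion classes have Σ_{V(G)} = 0 because ℤ is
-- torsion-free, so the bijection also matches the torsion subgroups.
module Submission where

open import Defs
open import Data.Nat as ℕ using (ℕ; zero; suc)
open import Data.Integer using (ℤ; +_; 0ℤ; 1ℤ; -1ℤ; -_; _-_; _+_; _*_)
import Data.Integer.Properties as ℤ
open import Data.Integer.Tactic.RingSolver using (solve-∀)
open import Data.Fin using (Fin; zero; suc; join; splitAt; _↑ˡ_; _↑ʳ_; punchIn; punchOut; _≟_)
import Data.Fin.Properties as Fin
open import Data.Vec.Functional using (_++_; insertAt)
open import Data.Vec.Functional.Properties
  using (lookup-++ˡ; lookup-++ʳ; insertAt-lookup; insertAt-punchIn)
open import Data.Product using (Σ; ∃; _,_; _×_)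
open import Data.Sum using (inj₁; inj₂)
open import Data.Maybe using (nothing; just)
open import Data.Bool using (_∧_; if_then_else_)
open import Function using (_∘_)
open import Relation.Nullary using (yes; no; contradiction)
open import Relation.Nullary.Decidable using (⌊_⌋)
open import Relation.Binary.PropositionalEquality
open import Algebra.Morphism.Structures using (IsGroupIsomorphism)
open import Algebra.Properties.Semiring.Sum ℤ.+-*-semiring
  using (sum; sum-cong-≗; sum-replicate-zero; sum-remove; ∑-distrib-+; ∑-comm;
         *-distribˡ-sum; *-distribʳ-sum)
open ≡-Reasoning

private
  variable
    k l r : ℕ

-- Finite index sets and sums

↑ˡ≢↑ʳ : ∀ {m n} (i : Fin m) (j : Fin n) → i ↑ˡ n ≢ m ↑ʳ j
↑ˡ≢↑ʳ {m} {n} i j eq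
  with trans (sym (Fin.splitAt-↑ˡ m i n)) (trans (cong (splitAt m) eq) (Fin.splitAt-↑ʳ m n j))
... | ()

↑-elim : ∀ {m n} {P : Fin (m ℕ.+ n) → Set} →
         (∀ i → P (i ↑ˡ n)) → (∀ j → P (m ↑ʳ j)) → ∀ x → P x
↑-elim {m} {n} {P} Pˡ Pʳ x = subst P (Fin.join-splitAt m n x) (P-join (splitAt m x))
  where
  P-join : ∀ s → P (join m n s)
  P-join (inj₁ i) = Pˡ i
  P-join (inj₂ j) = Pʳ j

punchIn-elim : ∀ {P : Fin (suc k) → Set} (w : Fin (suc k)) →
               P w → (∀ c → P (punchIn w c)) → ∀ j → P j
punchIn-elim {P = P} w Pw Pc j with w ≟ j
... | yes refl = Pw
... | no w≢j   = subst P (Fin.punchIn-punchOut w≢j) (Pc (punchOut w≢j))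

sumℤ≡sum : (f : Fin k → ℤ) → sumℤ f ≡ sum f
sumℤ≡sum {zero}  f = refl
sumℤ≡sum {suc k} f = cong (_+_ (f zero)) (sumℤ≡sum (f ∘ suc))

+sumℕ≡sum : (f : Fin k → ℕ) → + sumℕ f ≡ sum (λ i → + f i)
+sumℕ≡sum {zero}  f = refl
+sumℕ≡sum {suc k} f = trans (ℤ.pos-+ (f zero) _) (cong (_+_ (+ f zero)) (+sumℕ≡sum (f ∘ suc)))

sum-zero : {f : Fin k → ℤ} → (∀ i → f i ≡ 0ℤ) → sum f ≡ 0ℤ
sum-zero {k} f≗0 = trans (sum-cong-≗ f≗0) (sum-replicate-zero k)

neg-distrib-sum : (f : Fin k → ℤ) → - sum f ≡ sum (λ i → - f i)
neg-distrib-sum f = begin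
  - sum f                  ≡⟨ ℤ.-1*i≡-i _ ⟨
  -1ℤ * sum f              ≡⟨ *-distribˡ-sum -1ℤ f ⟩
  sum (λ i → -1ℤ * f i)    ≡⟨ sum-cong-≗ (λ i → ℤ.-1*i≡-i (f i)) ⟩
  sum (λ i → - f i)        ∎

∑-distrib-− : (f g : Fin k → ℤ) → sum (λ i → f i - g i) ≡ sum f - sum g
∑-distrib-− f g = trans (∑-distrib-+ f (λ i → - g i)) (cong (_+_ (sum f)) (sym (neg-distrib-sum g)))

sum-↑ : ∀ m {n} (f : Fin (m ℕ.+ n) → ℤ) → sum f ≡ sum (λ i → f (i ↑ˡ n)) + sum (λ j → f (m ↑ʳ j))
sum-↑ zero    f = sym (ℤ.+-identityˡ _)
sum-↑ (suc m) {n} f = trans (cong (_+_ (f zero)) (sum-↑ m (f ∘ suc)))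
  (sym (ℤ.+-assoc (f zero) (sum (λ i → f (suc i ↑ˡ n))) (sum (λ j → f (suc m ↑ʳ j)))))

sum-↑ˡ : ∀ m {n} {f : Fin (m ℕ.+ n) → ℤ} → (∀ j → f (m ↑ʳ j) ≡ 0ℤ) →
         sum f ≡ sum (λ i → f (i ↑ˡ n))
sum-↑ˡ m {n} {f} fʳ≗0 = trans (sum-↑ m f)
  (trans (cong (_+_ (sum (λ i → f (i ↑ˡ n)))) (sum-zero fʳ≗0)) (ℤ.+-identityʳ _))

sum-↑ʳ : ∀ m {n} {f : Fin (m ℕ.+ n) → ℤ} → (∀ i → f (i ↑ˡ n) ≡ 0ℤ) →
         sum f ≡ sum (λ j → f (m ↑ʳ j))
sum-↑ʳ m {f = f} fˡ≗0 = trans (sum-↑ m f)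
  (trans (cong (_+ sum (λ j → f (m ↑ʳ j))) (sum-zero fˡ≗0)) (ℤ.+-identityˡ _))

χ : Fin k → Fin k → ℤ
χ a b = if ⌊ a ≟ b ⌋ then 1ℤ else 0ℤ

χ-refl : (a : Fin k) → χ a a ≡ 1ℤ
χ-refl a with a ≟ a
... | yes _   = refl
... | no a≢a = contradiction refl a≢a

χ-≢ : {a b : Fin k} → a ≢ b → χ a b ≡ 0ℤ
χ-≢ {a = a} {b} a≢b with a ≟ b
... | yes a≡b = contradiction a≡b a≢b
... | no _    = refl

χ-sym : (a b : Fin k) → χ a b ≡ χ b a
χ-sym a b with a ≟ b
... | yes refl = sym (χ-refl a)
... | no a≢b   = sym (χ-≢ (a≢b ∘ sym))

χ-injective : {f : Fin k → Fin l} → (∀ {a b} → f a ≡ f b → a ≡ b) → ∀ a b → χ (f a) (f b) ≡ χ a b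
χ-injective f-inj a b with a ≟ b
... | yes refl = χ-refl _
... | no a≢b   = χ-≢ (a≢b ∘ f-inj)

χ-subst : (a b : Fin k) (f : Fin k → ℤ) → χ a b * f a ≡ χ a b * f b
χ-subst a b f with a ≟ b
... | yes refl = refl
... | no _     = refl

sum-χ : (a : Fin k) (f : Fin k → ℤ) → sum (λ b → χ a b * f b) ≡ f a
sum-χ {suc k} a f = begin
  sum (λ b → χ a b * f b)
    ≡⟨ sum-remove {i = a} (λ b → χ a b * f b) ⟩
  χ a a * f a + sum (λ c → χ a (punchIn a c) * f (punchIn a c))
    ≡⟨ cong₂ _+_ (cong (_* f a) (χ-refl a))
                 (sum-zero (λ c → cong (_* f (punchIn a c)) (χ-≢ (Fin.punchInᵢ≢i a c ∘ sym)))) ⟩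
  1ℤ * f a + 0ℤ
    ≡⟨ trans (ℤ.+-identityʳ _) (ℤ.*-identityˡ _) ⟩
  f a ∎

sum-χ′ : (b : Fin k) (f : Fin k → ℤ) → sum (λ a → χ a b * f a) ≡ f b
sum-χ′ b f = trans (sum-cong-≗ (λ a → cong (_* f a) (χ-sym a b))) (sum-χ b f)

δ-χ : (a b : Fin k) (m : ℕ) → + δ a b m ≡ χ a b * + m
δ-χ a b m with a ≟ b
... | yes _ = sym (ℤ.*-identityˡ (+ m))
... | no _  = refl

if∧-χ : (a b c d : Fin k) (m : ℕ) →
        + (if ⌊ a ≟ b ⌋ ∧ ⌊ c ≟ d ⌋ then m else 0) ≡ χ a b * (χ c d * + m)
if∧-χ a b c d m with a ≟ b | c ≟ d
... | yes _ | yes _ = sym (trans (ℤ.*-identityˡ _) (ℤ.*-identityˡ _))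
... | yes _ | no _  = sym (ℤ.*-identityˡ _)
... | no _  | _     = refl

-- Laplacians

infixr 7 _ᵀ·_

_ᵀ·_ : (Fin k → Fin l → ℤ) → (Fin k → ℤ) → Fin l → ℤ
(M ᵀ· z) b = sum (λ a → M a b * z a)

module _ (M : Fin k → Fin l → ℤ) where

  ᵀ·-cong : {x y : Fin k → ℤ} → (∀ a → x a ≡ y a) → ∀ b → (M ᵀ· x) b ≡ (M ᵀ· y) b
  ᵀ·-cong x≗y b = sum-cong-≗ (λ a → cong (M a b *_) (x≗y a))

  ᵀ·-0 : ∀ b → (M ᵀ· (λ _ → 0ℤ)) b ≡ 0ℤ
  ᵀ·-0 b = sum-zero (λ a → ℤ.*-zeroʳ (M a b))

  ᵀ·-+ : (x y : Fin k → ℤ) → ∀ b → (M ᵀ· (λ a → x a + y a)) b ≡ (M ᵀ· x) b + (M ᵀ· y) b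
  ᵀ·-+ x y b = trans (sum-cong-≗ (λ a → ℤ.*-distribˡ-+ (M a b) (x a) (y a)))
                     (∑-distrib-+ (λ a → M a b * x a) (λ a → M a b * y a))

  ᵀ·-neg : (x : Fin k → ℤ) → ∀ b → (M ᵀ· (λ a → - x a)) b ≡ - (M ᵀ· x) b
  ᵀ·-neg x b = trans (sum-cong-≗ (λ a → sym (ℤ.neg-distribʳ-* (M a b) (x a))))
                     (sym (neg-distrib-sum (λ a → M a b * x a)))

  ᵀ·-− : (x y : Fin k → ℤ) → ∀ b → (M ᵀ· (λ a → x a - y a)) b ≡ (M ᵀ· x) b - (M ᵀ· y) b
  ᵀ·-− x y b = trans (ᵀ·-+ x (λ a → - y a) b) (cong (_+_ ((M ᵀ· x) b)) (ᵀ·-neg y b))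

  ᵀ·-*ˡ : (c : ℤ) (x : Fin k → ℤ) → ∀ b → (M ᵀ· (λ a → c * x a)) b ≡ c * (M ᵀ· x) b
  ᵀ·-*ˡ c x b = trans (sum-cong-≗ (λ a → swap (M a b) c (x a))) (sym (*-distribˡ-sum c (λ a → M a b * x a)))
    where
    swap : ∀ p c x → p * (c * x) ≡ c * (p * x)
    swap = solve-∀

  ᵀ·-*ʳ : (x : Fin k → ℤ) (c : ℤ) → ∀ b → (M ᵀ· (λ a → x a * c)) b ≡ (M ᵀ· x) b * c
  ᵀ·-*ʳ x c b = begin
    (M ᵀ· (λ a → x a * c)) b ≡⟨ ᵀ·-cong (λ a → ℤ.*-comm (x a) c) b ⟩
    (M ᵀ· (λ a → c * x a)) b ≡⟨ ᵀ·-*ˡ c x b ⟩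
    c * (M ᵀ· x) b           ≡⟨ ℤ.*-comm c _ ⟩
    (M ᵀ· x) b * c           ∎

  ᵀ·-sum : (F : Fin r → Fin k → ℤ) → ∀ b →
           (M ᵀ· (λ a → sum (λ u → F u a))) b ≡ sum (λ u → (M ᵀ· F u) b)
  ᵀ·-sum F b = begin
    sum (λ a → M a b * sum (λ u → F u a))
      ≡⟨ sum-cong-≗ (λ a → *-distribˡ-sum (M a b) (λ u → F u a)) ⟩
    sum (λ a → sum (λ u → M a b * F u a))
      ≡⟨ ∑-comm (λ a u → M a b * F u a) ⟩
    sum (λ u → sum (λ a → M a b * F u a)) ∎

  sum-ᵀ· : (x : Fin k → ℤ) → sum (M ᵀ· x) ≡ sum (λ a → sum (M a) * x a)
  sum-ᵀ· x = begin
    sum (λ b → sum (λ a → M a b * x a))  ≡⟨ ∑-comm (λ b a → M a b * x a) ⟩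
    sum (λ a → sum (λ b → M a b * x a))  ≡⟨ sum-cong-≗ (λ a → sym (*-distribʳ-sum (x a) (M a))) ⟩
    sum (λ a → sum (M a) * x a)          ∎

Eulerian : Graph → Set
Eulerian Γ = ∀ v → indeg Γ v ≡ outdeg Γ v

module _ (Γ : Graph) where

  Qᵀ≡Lapᵀ· : (z : Fin (n Γ) → ℤ) → ∀ v → Qᵀ Γ z v ≡ (Lap Γ ᵀ· z) v
  Qᵀ≡Lapᵀ· z v = sumℤ≡sum (λ u → Lap Γ u v * z u)

  +outdeg≡sum : ∀ u → + outdeg Γ u ≡ sum (λ v → + A Γ u v)
  +outdeg≡sum u = +sumℕ≡sum (A Γ u)

  Lapᵀ·-expand : (z : Fin (n Γ) → ℤ) → ∀ v →
                 (Lap Γ ᵀ· z) v ≡ + outdeg Γ v * z v - sum (λ u → + A Γ u v * z u)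
  Lapᵀ·-expand z v = begin
    sum (λ u → Lap Γ u v * z u)
      ≡⟨ sum-cong-≗ (λ u → trans (cong (λ d → (d - + A Γ u v) * z u) (δ-χ u v (outdeg Γ u)))
                                 (distrib (χ u v) (+ outdeg Γ u) (+ A Γ u v) (z u))) ⟩
    sum (λ u → χ u v * (+ outdeg Γ u * z u) - + A Γ u v * z u)
      ≡⟨ ∑-distrib-− (λ u → χ u v * (+ outdeg Γ u * z u)) (λ u → + A Γ u v * z u) ⟩
    sum (λ u → χ u v * (+ outdeg Γ u * z u)) - sum (λ u → + A Γ u v * z u)
      ≡⟨ cong (_- sum (λ u → + A Γ u v * z u)) (sum-χ′ v (λ u → + outdeg Γ u * z u)) ⟩
    + outdeg Γ v * z v - sum (λ u → + A Γ u v * z u) ∎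
    where
    distrib : ∀ c d a z → (c * d - a) * z ≡ c * (d * z) - a * z
    distrib = solve-∀

  sum-Lap-row : ∀ u → sum (Lap Γ u) ≡ 0ℤ
  sum-Lap-row u = begin
    sum (λ v → + δ u v (outdeg Γ u) - + A Γ u v)
      ≡⟨ ∑-distrib-− (λ v → + δ u v (outdeg Γ u)) (λ v → + A Γ u v) ⟩
    sum (λ v → + δ u v (outdeg Γ u)) - sum (λ v → + A Γ u v)
      ≡⟨ cong₂ _-_ (trans (sum-cong-≗ (λ v → δ-χ u v (outdeg Γ u))) (sum-χ u (λ _ → + outdeg Γ u)))
                   (sym (+outdeg≡sum u)) ⟩
    + outdeg Γ u - + outdeg Γ u
      ≡⟨ ℤ.+-inverseʳ (+ outdeg Γ u) ⟩
    0ℤ ∎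

  sum-Lapᵀ· : (z : Fin (n Γ) → ℤ) → sum (Lap Γ ᵀ· z) ≡ 0ℤ
  sum-Lapᵀ· z = trans (sum-ᵀ· (Lap Γ) z) (sum-zero (λ u → cong (_* z u) (sum-Lap-row u)))

  Lapᵀ·-const : Eulerian Γ → ∀ v → (Lap Γ ᵀ· (λ _ → 1ℤ)) v ≡ 0ℤ
  Lapᵀ·-const eulerian v = begin
    (Lap Γ ᵀ· (λ _ → 1ℤ)) v
      ≡⟨ Lapᵀ·-expand (λ _ → 1ℤ) v ⟩
    + outdeg Γ v * 1ℤ - sum (λ u → + A Γ u v * 1ℤ)
      ≡⟨ cong₂ _-_ (ℤ.*-identityʳ (+ outdeg Γ v))
                   (trans (sum-cong-≗ (λ u → ℤ.*-identityʳ (+ A Γ u v)))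
                          (sym (+sumℕ≡sum (λ u → A Γ u v)))) ⟩
    + outdeg Γ v - + indeg Γ v
      ≡⟨ cong (λ d → + outdeg Γ v - + d) (eulerian v) ⟩
    + outdeg Γ v - + outdeg Γ v
      ≡⟨ ℤ.+-inverseʳ (+ outdeg Γ v) ⟩
    0ℤ ∎

  ≗⇒Congruent : {x y : Fin (n Γ) → ℤ} → (∀ v → x v ≡ y v) → Congruent Γ x y
  ≗⇒Congruent {x} {y} x≗y = (λ _ → 0ℤ) , λ v → begin
    x v - y v                ≡⟨ cong (_- y v) (x≗y v) ⟩
    y v - y v                ≡⟨ ℤ.+-inverseʳ (y v) ⟩
    0ℤ                       ≡⟨ ᵀ·-0 (Lap Γ) v ⟨
    (Lap Γ ᵀ· (λ _ → 0ℤ)) v  ≡⟨ Qᵀ≡Lapᵀ· _ v ⟨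
    Qᵀ Γ (λ _ → 0ℤ) v        ∎

  Congruent-resp : {x y x′ y′ : Fin (n Γ) → ℤ} →
                   Congruent Γ x y → (∀ v → x v ≡ x′ v) → (∀ v → y v ≡ y′ v) → Congruent Γ x′ y′
  Congruent-resp (z , x-y≡Qᵀz) x≗x′ y≗y′ =
    z , λ v → trans (sym (cong₂ _-_ (x≗x′ v) (y≗y′ v))) (x-y≡Qᵀz v)

-- Quotient graphs

-- identify G H v w is by definition quotient (G ∪ᴳ H) (identifyMap G H v w).
quotient : (Γ : Graph) → (Fin (n Γ) → Fin l) → Graph
quotient {l} Γ π = record
  { n = l
  ; A = λ a b → sumℕ (λ x → sumℕ (λ y → if ⌊ π x ≟ a ⌋ ∧ ⌊ π y ≟ b ⌋ then A Γ x y else 0))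
  }

-- push π y b is the sum of y over the fibre of π above b.
push : (Fin k → Fin l) → (Fin k → ℤ) → Fin l → ℤ
push π y = (χ ∘ π) ᵀ· y

module _ (π : Fin k → Fin l) where

  push-projection : (f : Fin k → ℤ) (g : Fin l → ℤ) → ∀ b →
                    push π (λ x → f x * g (π x)) b ≡ push π f b * g b
  push-projection f g b = begin
    sum (λ x → χ (π x) b * (f x * g (π x)))  ≡⟨ sum-cong-≗ (λ x → move (χ (π x) b) (f x) (g (π x))) ⟩
    sum (λ x → χ (π x) b * g (π x) * f x)    ≡⟨ sum-cong-≗ (λ x → cong (_* f x) (χ-subst (π x) b g)) ⟩
    sum (λ x → χ (π x) b * g b * f x)        ≡⟨ sum-cong-≗ (λ x → move′ (χ (π x) b) (g b) (f x)) ⟩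
    sum (λ x → χ (π x) b * f x * g b)        ≡⟨ *-distribʳ-sum (g b) (λ x → χ (π x) b * f x) ⟨
    push π f b * g b                         ∎
    where
    move : ∀ c f g → c * (f * g) ≡ c * g * f
    move = solve-∀
    move′ : ∀ c g f → c * g * f ≡ c * f * g
    move′ = solve-∀

  sum-push : (y : Fin k → ℤ) → sum (push π y) ≡ sum y
  sum-push y = trans (sum-ᵀ· (χ ∘ π) y)
                     (sum-cong-≗ (λ x → trans (cong (_* y x) (row-sum x)) (ℤ.*-identityˡ (y x))))
    where
    row-sum : ∀ x → sum (χ (π x)) ≡ 1ℤ
    row-sum x = trans (sum-cong-≗ (λ b → sym (ℤ.*-identityʳ (χ (π x) b)))) (sum-χ (π x) (λ _ → 1ℤ))

  push-adjoint : (f : Fin k → ℤ) (g : Fin l → ℤ) → sum (λ a → push π f a * g a) ≡ sum (λ x → f x * g (π x))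
  push-adjoint f g = begin
    sum (λ a → push π f a * g a)
      ≡⟨ sum-cong-≗ (λ a → *-distribʳ-sum (g a) (λ x → χ (π x) a * f x)) ⟩
    sum (λ a → sum (λ x → χ (π x) a * f x * g a))
      ≡⟨ ∑-comm (λ a x → χ (π x) a * f x * g a) ⟩
    sum (λ x → sum (λ a → χ (π x) a * f x * g a))
      ≡⟨ sum-cong-≗ (λ x → sum-cong-≗ (λ a → move (χ (π x) a) (f x) (g a))) ⟩
    sum (λ x → sum (λ a → χ (π x) a * (f x * g a)))
      ≡⟨ sum-cong-≗ (λ x → sum-χ (π x) (λ a → f x * g a)) ⟩
    sum (λ x → f x * g (π x)) ∎
    where
    move : ∀ c f g → c * f * g ≡ c * (f * g)
    move = solve-∀

module _ (Γ : Graph) (π : Fin (n Γ) → Fin l) where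

  private
    Γ′ : Graph
    Γ′ = quotient Γ π

  +A-quotient : ∀ a b → + A Γ′ a b ≡ push π (λ u → push π (λ x → + A Γ u x) b) a
  +A-quotient a b = begin
    + A Γ′ a b
      ≡⟨ +sumℕ≡sum (λ u → sumℕ (edges u)) ⟩
    sum (λ u → + sumℕ (edges u))
      ≡⟨ sum-cong-≗ (λ u → trans (+sumℕ≡sum (edges u))
                                 (sum-cong-≗ (λ x → if∧-χ (π u) a (π x) b (A Γ u x)))) ⟩
    sum (λ u → sum (λ x → χ (π u) a * (χ (π x) b * + A Γ u x)))
      ≡⟨ sum-cong-≗ (λ u → *-distribˡ-sum (χ (π u) a) (λ x → χ (π x) b * + A Γ u x)) ⟨
    push π (λ u → push π (λ x → + A Γ u x) b) a ∎
    where
    edges : Fin (n Γ) → Fin (n Γ) → ℕ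
    edges u x = if ⌊ π u ≟ a ⌋ ∧ ⌊ π x ≟ b ⌋ then A Γ u x else 0

  +outdeg-quotient : ∀ a → + outdeg Γ′ a ≡ push π (λ u → + outdeg Γ u) a
  +outdeg-quotient a = begin
    + outdeg Γ′ a
      ≡⟨ +outdeg≡sum Γ′ a ⟩
    sum (λ b → + A Γ′ a b)
      ≡⟨ sum-cong-≗ (+A-quotient a) ⟩
    sum (λ b → push π (λ u → push π (λ x → + A Γ u x) b) a)
      ≡⟨ ᵀ·-sum (χ ∘ π) (λ b u → push π (λ x → + A Γ u x) b) a ⟨
    push π (λ u → sum (push π (λ x → + A Γ u x))) a
      ≡⟨ ᵀ·-cong (χ ∘ π) (λ u → trans (sum-push π (λ x → + A Γ u x)) (sym (+outdeg≡sum Γ u))) a ⟩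
    push π (λ u → + outdeg Γ u) a ∎

  sum-+A-quotient : (z′ : Fin l → ℤ) → ∀ b →
                    sum (λ a → + A Γ′ a b * z′ a) ≡ push π (λ x → sum (λ u → + A Γ u x * z′ (π u))) b
  sum-+A-quotient z′ b = begin
    sum (λ a → + A Γ′ a b * z′ a)
      ≡⟨ sum-cong-≗ (λ a → cong (_* z′ a) (+A-quotient a b)) ⟩
    sum (λ a → push π (λ u → push π (λ x → + A Γ u x) b) a * z′ a)
      ≡⟨ push-adjoint π (λ u → push π (λ x → + A Γ u x) b) z′ ⟩
    sum (λ u → push π (λ x → + A Γ u x) b * z′ (π u))
      ≡⟨ sum-cong-≗ (λ u → ᵀ·-*ʳ (χ ∘ π) (λ x → + A Γ u x) (z′ (π u)) b) ⟨
    sum (λ u → push π (λ x → + A Γ u x * z′ (π u)) b)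
      ≡⟨ ᵀ·-sum (χ ∘ π) (λ u x → + A Γ u x * z′ (π u)) b ⟨
    push π (λ x → sum (λ u → + A Γ u x * z′ (π u))) b ∎

  -- In matrix form Q′ = Pᵀ Q P, with P x b = [π x = b].
  Lapᵀ·-quotient : (z′ : Fin l → ℤ) → ∀ b → (Lap Γ′ ᵀ· z′) b ≡ push π (Lap Γ ᵀ· (z′ ∘ π)) b
  Lapᵀ·-quotient z′ b = begin
    (Lap Γ′ ᵀ· z′) b
      ≡⟨ Lapᵀ·-expand Γ′ z′ b ⟩
    + outdeg Γ′ b * z′ b - sum (λ a → + A Γ′ a b * z′ a)
      ≡⟨ cong₂ _-_ (trans (cong (_* z′ b) (+outdeg-quotient b))
                          (sym (push-projection π (λ x → + outdeg Γ x) z′ b)))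
                   (sum-+A-quotient z′ b) ⟩
    push π (λ x → + outdeg Γ x * z′ (π x)) b - push π (λ x → sum (λ u → + A Γ u x * z′ (π u))) b
      ≡⟨ ᵀ·-− (χ ∘ π) (λ x → + outdeg Γ x * z′ (π x))
                      (λ x → sum (λ u → + A Γ u x * z′ (π u))) b ⟨
    push π (λ x → + outdeg Γ x * z′ (π x) - sum (λ u → + A Γ u x * z′ (π u))) b
      ≡⟨ ᵀ·-cong (χ ∘ π) (λ x → sym (Lapᵀ·-expand Γ (z′ ∘ π) x)) b ⟩
    push π (Lap Γ ᵀ· (z′ ∘ π)) b ∎

-- Disjoint unions

module _ (G H : Graph) where

  private
    Γ : Graph
    Γ = G ∪ᴳ H

  𝟙ᴴ : Fin (n Γ) → ℤ
  𝟙ᴴ = (λ (_ : Fin (n G)) → 0ℤ) ++ (λ (_ : Fin (n H)) → 1ℤ)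

  𝟙ᴴ-↑ˡ : ∀ i → 𝟙ᴴ (i ↑ˡ n H) ≡ 0ℤ
  𝟙ᴴ-↑ˡ = lookup-++ˡ (λ (_ : Fin (n G)) → 0ℤ) (λ _ → 1ℤ)

  𝟙ᴴ-↑ʳ : ∀ j → 𝟙ᴴ (n G ↑ʳ j) ≡ 1ℤ
  𝟙ᴴ-↑ʳ = lookup-++ʳ (λ (_ : Fin (n G)) → 0ℤ) (λ _ → 1ℤ)

  A-∪ˡˡ : ∀ i j → A Γ (i ↑ˡ n H) (j ↑ˡ n H) ≡ A G i j
  A-∪ˡˡ i j rewrite Fin.splitAt-↑ˡ (n G) i (n H) | Fin.splitAt-↑ˡ (n G) j (n H) = refl

  A-∪ˡʳ : ∀ i j → A Γ (i ↑ˡ n H) (n G ↑ʳ j) ≡ 0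
  A-∪ˡʳ i j rewrite Fin.splitAt-↑ˡ (n G) i (n H) | Fin.splitAt-↑ʳ (n G) (n H) j = refl

  A-∪ʳˡ : ∀ i j → A Γ (n G ↑ʳ i) (j ↑ˡ n H) ≡ 0
  A-∪ʳˡ i j rewrite Fin.splitAt-↑ʳ (n G) (n H) i | Fin.splitAt-↑ˡ (n G) j (n H) = refl

  A-∪ʳʳ : ∀ i j → A Γ (n G ↑ʳ i) (n G ↑ʳ j) ≡ A H i j
  A-∪ʳʳ i j rewrite Fin.splitAt-↑ʳ (n G) (n H) i | Fin.splitAt-↑ʳ (n G) (n H) j = refl

  +outdeg-∪ˡ : ∀ i → + outdeg Γ (i ↑ˡ n H) ≡ + outdeg G i
  +outdeg-∪ˡ i = begin
    + outdeg Γ (i ↑ˡ n H)                    ≡⟨ +outdeg≡sum Γ (i ↑ˡ n H) ⟩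
    sum (λ x → + A Γ (i ↑ˡ n H) x)           ≡⟨ sum-↑ˡ (n G) (λ j → cong +_ (A-∪ˡʳ i j)) ⟩
    sum (λ j → + A Γ (i ↑ˡ n H) (j ↑ˡ n H))  ≡⟨ sum-cong-≗ (λ j → cong +_ (A-∪ˡˡ i j)) ⟩
    sum (λ j → + A G i j)                    ≡⟨ +outdeg≡sum G i ⟨
    + outdeg G i                             ∎

  +outdeg-∪ʳ : ∀ i → + outdeg Γ (n G ↑ʳ i) ≡ + outdeg H i
  +outdeg-∪ʳ i = begin
    + outdeg Γ (n G ↑ʳ i)                    ≡⟨ +outdeg≡sum Γ (n G ↑ʳ i) ⟩
    sum (λ x → + A Γ (n G ↑ʳ i) x)           ≡⟨ sum-↑ʳ (n G) (λ j → cong +_ (A-∪ʳˡ i j)) ⟩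
    sum (λ j → + A Γ (n G ↑ʳ i) (n G ↑ʳ j))  ≡⟨ sum-cong-≗ (λ j → cong +_ (A-∪ʳʳ i j)) ⟩
    sum (λ j → + A H i j)                    ≡⟨ +outdeg≡sum H i ⟨
    + outdeg H i                             ∎

  Lapᵀ·-∪ˡ : (z : Fin (n Γ) → ℤ) → ∀ i → (Lap Γ ᵀ· z) (i ↑ˡ n H) ≡ (Lap G ᵀ· (z ∘ (_↑ˡ n H))) i
  Lapᵀ·-∪ˡ z i = begin
    (Lap Γ ᵀ· z) (i ↑ˡ n H)
      ≡⟨ Lapᵀ·-expand Γ z (i ↑ˡ n H) ⟩
    + outdeg Γ (i ↑ˡ n H) * z (i ↑ˡ n H) - sum (λ u → + A Γ u (i ↑ˡ n H) * z u)
      ≡⟨ cong₂ (λ d s → d * z (i ↑ˡ n H) - s) (+outdeg-∪ˡ i) in-sum ⟩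
    + outdeg G i * z (i ↑ˡ n H) - sum (λ j → + A G j i * z (j ↑ˡ n H))
      ≡⟨ Lapᵀ·-expand G (z ∘ (_↑ˡ n H)) i ⟨
    (Lap G ᵀ· (z ∘ (_↑ˡ n H))) i ∎
    where
    in-sum : sum (λ u → + A Γ u (i ↑ˡ n H) * z u) ≡ sum (λ j → + A G j i * z (j ↑ˡ n H))
    in-sum = trans (sum-↑ˡ (n G) (λ j → cong (λ e → + e * z (n G ↑ʳ j)) (A-∪ʳˡ j i)))
                   (sum-cong-≗ (λ j → cong (λ e → + e * z (j ↑ˡ n H)) (A-∪ˡˡ j i)))

  Lapᵀ·-∪ʳ : (z : Fin (n Γ) → ℤ) → ∀ i → (Lap Γ ᵀ· z) (n G ↑ʳ i) ≡ (Lap H ᵀ· (z ∘ (n G ↑ʳ_))) i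
  Lapᵀ·-∪ʳ z i = begin
    (Lap Γ ᵀ· z) (n G ↑ʳ i)
      ≡⟨ Lapᵀ·-expand Γ z (n G ↑ʳ i) ⟩
    + outdeg Γ (n G ↑ʳ i) * z (n G ↑ʳ i) - sum (λ u → + A Γ u (n G ↑ʳ i) * z u)
      ≡⟨ cong₂ (λ d s → d * z (n G ↑ʳ i) - s) (+outdeg-∪ʳ i) in-sum ⟩
    + outdeg H i * z (n G ↑ʳ i) - sum (λ j → + A H j i * z (n G ↑ʳ j))
      ≡⟨ Lapᵀ·-expand H (z ∘ (n G ↑ʳ_)) i ⟨
    (Lap H ᵀ· (z ∘ (n G ↑ʳ_))) i ∎
    where
    in-sum : sum (λ u → + A Γ u (n G ↑ʳ i) * z u) ≡ sum (λ j → + A H j i * z (n G ↑ʳ j))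
    in-sum = trans (sum-↑ʳ (n G) (λ j → cong (λ e → + e * z (j ↑ˡ n H)) (A-∪ˡʳ j i)))
                   (sum-cong-≗ (λ j → cong (λ e → + e * z (n G ↑ʳ j)) (A-∪ʳʳ j i)))

  Lapᵀ·-∪-𝟙ᴴ : Eulerian H → ∀ u → (Lap Γ ᵀ· 𝟙ᴴ) u ≡ 0ℤ
  Lapᵀ·-∪-𝟙ᴴ H-eulerian = ↑-elim {P = λ u → (Lap Γ ᵀ· 𝟙ᴴ) u ≡ 0ℤ}
    (λ i → trans (Lapᵀ·-∪ˡ 𝟙ᴴ i) (trans (ᵀ·-cong (Lap G) 𝟙ᴴ-↑ˡ i) (ᵀ·-0 (Lap G) i)))
    (λ j → trans (Lapᵀ·-∪ʳ 𝟙ᴴ j) (trans (ᵀ·-cong (Lap H) 𝟙ᴴ-↑ʳ j) (Lapᵀ·-const H H-eulerian j)))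

-- Identifying v ∈ V(G) with w ∈ V(H)

removeAt-self : (w : Fin (suc k)) → removeAt w w ≡ nothing
removeAt-self w with w ≟ w
... | yes _   = refl
... | no w≢w = contradiction refl w≢w

removeAt-punchIn : (w : Fin (suc k)) (c : Fin k) → removeAt w (punchIn w c) ≡ just c
removeAt-punchIn w c with w ≟ punchIn w c
... | yes w≡c = contradiction (sym w≡c) (Fin.punchInᵢ≢i w c)
... | no _    = cong just (trans (Fin.punchOut-cong w refl) (Fin.punchOut-punchIn w))

module Identification (G : Graph) {m : ℕ} (AH : Fin (suc m) → Fin (suc m) → ℕ)
                      (v : Fin (n G)) (w : Fin (suc m)) where

  private
    H : Graph
    H = record { n = suc m ; A = AH }

    Γ Γ′ : Graph
    Γ  = G ∪ᴳ H
    Γ′ = identify G H v w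

    π : Fin (n Γ) → Fin (n Γ′)
    π = identifyMap G H v w

    L : Fin (n G) → Fin (n Γ)
    L = _↑ˡ suc m

    R : Fin (suc m) → Fin (n Γ)
    R = n G ↑ʳ_

    L′ : Fin (n G) → Fin (n Γ′)
    L′ = _↑ˡ m

    R′ : Fin m → Fin (n Γ′)
    R′ = n G ↑ʳ_

  π-L : ∀ i → π (L i) ≡ L′ i
  π-L i rewrite Fin.splitAt-↑ˡ (n G) i (suc m) = refl

  π-w : π (R w) ≡ L′ v
  π-w rewrite Fin.splitAt-↑ʳ (n G) (suc m) w | removeAt-self w = refl

  π-R : ∀ c → π (R (punchIn w c)) ≡ R′ c
  π-R c rewrite Fin.splitAt-↑ʳ (n G) (suc m) (punchIn w c) | removeAt-punchIn w c = refl

  sum-vertices : (f : Fin (n Γ) → ℤ) → sum f ≡ sum (f ∘ L) + (f (R w) + sum (λ c → f (R (punchIn w c))))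
  sum-vertices f = trans (sum-↑ (n G) f) (cong (_+_ (sum (f ∘ L))) (sum-remove {i = w} (f ∘ R)))

  push-L′ : (y : Fin (n Γ) → ℤ) → ∀ k → push π y (L′ k) ≡ y (L k) + χ v k * y (R w)
  push-L′ y k = begin
    push π y (L′ k)
      ≡⟨ sum-vertices (λ x → χ (π x) (L′ k) * y x) ⟩
    sum (λ i → χ (π (L i)) (L′ k) * y (L i))
      + (χ (π (R w)) (L′ k) * y (R w) + sum (λ c → χ (π (R (punchIn w c))) (L′ k) * y (R (punchIn w c))))
      ≡⟨ cong₂ _+_ on-G (cong₂ _+_ (cong (_* y (R w)) at-w) (sum-zero on-H)) ⟩
    y (L k) + (χ v k * y (R w) + 0ℤ)
      ≡⟨ cong (_+_ (y (L k))) (ℤ.+-identityʳ _) ⟩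
    y (L k) + χ v k * y (R w) ∎
    where
    χ-L′ : ∀ i → χ (L′ i) (L′ k) ≡ χ i k
    χ-L′ i = χ-injective (λ {a} {b} → Fin.↑ˡ-injective m a b) i k
    on-G : sum (λ i → χ (π (L i)) (L′ k) * y (L i)) ≡ y (L k)
    on-G = trans (sum-cong-≗ (λ i → cong (_* y (L i)) (trans (cong (λ a → χ a (L′ k)) (π-L i)) (χ-L′ i))))
                 (sum-χ′ k (y ∘ L))
    at-w : χ (π (R w)) (L′ k) ≡ χ v k
    at-w = trans (cong (λ a → χ a (L′ k)) π-w) (χ-L′ v)
    on-H : ∀ c → χ (π (R (punchIn w c))) (L′ k) * y (R (punchIn w c)) ≡ 0ℤ
    on-H c = cong (_* y (R (punchIn w c)))
                  (trans (cong (λ a → χ a (L′ k)) (π-R c)) (χ-≢ (↑ˡ≢↑ʳ k c ∘ sym)))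

  push-R′ : (y : Fin (n Γ) → ℤ) → ∀ d → push π y (R′ d) ≡ y (R (punchIn w d))
  push-R′ y d = begin
    push π y (R′ d)
      ≡⟨ sum-vertices (λ x → χ (π x) (R′ d) * y x) ⟩
    sum (λ i → χ (π (L i)) (R′ d) * y (L i))
      + (χ (π (R w)) (R′ d) * y (R w) + sum (λ c → χ (π (R (punchIn w c))) (R′ d) * y (R (punchIn w c))))
      ≡⟨ cong₂ _+_ (sum-zero on-G) (cong₂ _+_ (cong (_* y (R w)) at-w) on-H) ⟩
    0ℤ + (0ℤ * y (R w) + y (R (punchIn w d)))
      ≡⟨ trans (ℤ.+-identityˡ _) (ℤ.+-identityˡ _) ⟩
    y (R (punchIn w d)) ∎
    where
    χ-R′ : ∀ c → χ (R′ c) (R′ d) ≡ χ c d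
    χ-R′ c = χ-injective (λ {a} {b} → Fin.↑ʳ-injective (n G) a b) c d
    on-G : ∀ i → χ (π (L i)) (R′ d) * y (L i) ≡ 0ℤ
    on-G i = cong (_* y (L i)) (trans (cong (λ a → χ a (R′ d)) (π-L i)) (χ-≢ (↑ˡ≢↑ʳ i d)))
    at-w : χ (π (R w)) (R′ d) ≡ 0ℤ
    at-w = trans (cong (λ a → χ a (R′ d)) π-w) (χ-≢ (↑ˡ≢↑ʳ v d))
    on-H : sum (λ c → χ (π (R (punchIn w c))) (R′ d) * y (R (punchIn w c))) ≡ y (R (punchIn w d))
    on-H = trans (sum-cong-≗ (λ c → cong (_* y (R (punchIn w c)))
                                         (trans (cong (λ a → χ a (R′ d)) (π-R c)) (χ-R′ c))))
                 (sum-χ′ d (λ c → y (R (punchIn w c))))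

  sumᴳ : (Fin (n Γ) → ℤ) → ℤ
  sumᴳ y = sum (y ∘ L)

  sumᴳ-0 : sumᴳ (λ _ → 0ℤ) ≡ 0ℤ
  sumᴳ-0 = sum-replicate-zero (n G)

  sumᴳ-Lapᵀ· : (z : Fin (n Γ) → ℤ) → sumᴳ (Lap Γ ᵀ· z) ≡ 0ℤ
  sumᴳ-Lapᵀ· z = trans (sum-cong-≗ (Lapᵀ·-∪ˡ G H z)) (sum-Lapᵀ· G (z ∘ L))

  sumᴳ-Congruent : {x y : Fin (n Γ) → ℤ} → Congruent Γ x y → sumᴳ x ≡ sumᴳ y
  sumᴳ-Congruent {x} {y} (z , x-y≡Qᵀz) = ℤ.i-j≡0⇒i≡j _ _ (begin
    sumᴳ x - sumᴳ y                ≡⟨ ∑-distrib-− (x ∘ L) (y ∘ L) ⟨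
    sum (λ i → x (L i) - y (L i))  ≡⟨ sum-cong-≗ (λ i → trans (x-y≡Qᵀz (L i)) (Qᵀ≡Lapᵀ· Γ z (L i))) ⟩
    sumᴳ (Lap Γ ᵀ· z)              ≡⟨ sumᴳ-Lapᵀ· z ⟩
    0ℤ                             ∎)

  push-sumᴳ-injective : (e : Fin (n Γ) → ℤ) →
                        (∀ b → push π e b ≡ 0ℤ) → sumᴳ e ≡ 0ℤ → ∀ x → e x ≡ 0ℤ
  push-sumᴳ-injective e push≡0 sum≡0 =
    ↑-elim {P = λ x → e x ≡ 0ℤ} e-L (punchIn-elim {P = λ j → e (R j) ≡ 0ℤ} w e-w e-R)
    where
    fibre-L : ∀ k → e (L k) + χ v k * e (R w) ≡ 0ℤ
    fibre-L k = trans (sym (push-L′ e k)) (push≡0 (L′ k))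
    e-w : e (R w) ≡ 0ℤ
    e-w = begin
      e (R w)                                ≡⟨ ℤ.+-identityˡ _ ⟨
      0ℤ + e (R w)                           ≡⟨ cong₂ _+_ sum≡0 (sum-χ v (λ _ → e (R w))) ⟨
      sumᴳ e + sum (λ k → χ v k * e (R w))   ≡⟨ ∑-distrib-+ (e ∘ L) (λ k → χ v k * e (R w)) ⟨
      sum (λ k → e (L k) + χ v k * e (R w))  ≡⟨ sum-zero fibre-L ⟩
      0ℤ                                     ∎
    e-L : ∀ k → e (L k) ≡ 0ℤ
    e-L k = begin
      e (L k)                    ≡⟨ ℤ.+-identityʳ _ ⟨
      e (L k) + 0ℤ               ≡⟨ cong (_+_ (e (L k))) (trans (cong (χ v k *_) e-w) (ℤ.*-zeroʳ (χ v k))) ⟨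
      e (L k) + χ v k * e (R w)  ≡⟨ fibre-L k ⟩
      0ℤ                         ∎
    e-R : ∀ c → e (R (punchIn w c)) ≡ 0ℤ
    e-R c = trans (sym (push-R′ e c)) (push≡0 (R′ c))

  push-sumᴳ-surjective : (y′ : Fin (n Γ′) → ℤ) (t : ℤ) →
                         ∃ λ y → (∀ b → push π y b ≡ y′ b) × sumᴳ y ≡ t
  push-sumᴳ-surjective y′ t = y , push-y , sum-y
    where
    c : ℤ
    c = t - sum (y′ ∘ L′)
    y : Fin (n Γ) → ℤ
    y = (λ k → y′ (L′ k) + χ k v * c) ++ insertAt (y′ ∘ R′) w (- c)
    y-L : ∀ k → y (L k) ≡ y′ (L′ k) + χ k v * c
    y-L = lookup-++ˡ (λ k → y′ (L′ k) + χ k v * c) (insertAt (y′ ∘ R′) w (- c))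
    y-R : ∀ j → y (R j) ≡ insertAt (y′ ∘ R′) w (- c) j
    y-R = lookup-++ʳ (λ k → y′ (L′ k) + χ k v * c) (insertAt (y′ ∘ R′) w (- c))
    push-y : ∀ b → push π y b ≡ y′ b
    push-y = ↑-elim {P = λ b → push π y b ≡ y′ b}
      (λ k → begin
        push π y (L′ k)                        ≡⟨ push-L′ y k ⟩
        y (L k) + χ v k * y (R w)              ≡⟨ cong₂ (λ p q → p + χ v k * q) (y-L k)
                                                        (trans (y-R w) (insertAt-lookup (y′ ∘ R′) w (- c))) ⟩
        y′ (L′ k) + χ k v * c + χ v k * - c    ≡⟨ cong (λ e → y′ (L′ k) + χ k v * c + e * - c) (χ-sym v k) ⟩
        y′ (L′ k) + χ k v * c + χ k v * - c    ≡⟨ cancel (y′ (L′ k)) (χ k v) c ⟩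
        y′ (L′ k)                              ∎)
      (λ d → trans (push-R′ y d) (trans (y-R (punchIn w d)) (insertAt-punchIn (y′ ∘ R′) w (- c) d)))
      where
      cancel : ∀ a e c → a + e * c + e * - c ≡ a
      cancel = solve-∀
    sum-y : sumᴳ y ≡ t
    sum-y = begin
      sum (y ∘ L)                            ≡⟨ sum-cong-≗ y-L ⟩
      sum (λ k → y′ (L′ k) + χ k v * c)      ≡⟨ ∑-distrib-+ (y′ ∘ L′) (λ k → χ k v * c) ⟩
      sum (y′ ∘ L′) + sum (λ k → χ k v * c)  ≡⟨ cong (_+_ (sum (y′ ∘ L′))) (sum-χ′ v (λ _ → c)) ⟩
      sum (y′ ∘ L′) + (t - sum (y′ ∘ L′))    ≡⟨ cancel (sum (y′ ∘ L′)) t ⟩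
      t                                      ∎
      where
      cancel : ∀ s t → s + (t - s) ≡ t
      cancel = solve-∀

  Congruent-reflect : {x y : Fin (n Γ) → ℤ} →
                      Congruent Γ′ (push π x) (push π y) → sumᴳ x ≡ sumᴳ y → Congruent Γ x y
  Congruent-reflect {x} {y} (z′ , push-x-y≡Qᵀz′) sumᴳx≡sumᴳy = z′ ∘ π , λ u → begin
    x u - y u               ≡⟨ ℤ.i-j≡0⇒i≡j _ _ (push-sumᴳ-injective e push-e sum-e u) ⟩
    (Lap Γ ᵀ· (z′ ∘ π)) u   ≡⟨ Qᵀ≡Lapᵀ· Γ (z′ ∘ π) u ⟨
    Qᵀ Γ (z′ ∘ π) u         ∎
    where
    e : Fin (n Γ) → ℤ
    e u = (x u - y u) - (Lap Γ ᵀ· (z′ ∘ π)) u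
    push-e : ∀ b → push π e b ≡ 0ℤ
    push-e b = begin
      push π e b
        ≡⟨ ᵀ·-− (χ ∘ π) (λ u → x u - y u) (Lap Γ ᵀ· (z′ ∘ π)) b ⟩
      push π (λ u → x u - y u) b - push π (Lap Γ ᵀ· (z′ ∘ π)) b
        ≡⟨ cong₂ _-_ (trans (ᵀ·-− (χ ∘ π) x y b) (trans (push-x-y≡Qᵀz′ b) (Qᵀ≡Lapᵀ· Γ′ z′ b)))
                     (sym (Lapᵀ·-quotient Γ π z′ b)) ⟩
      (Lap Γ′ ᵀ· z′) b - (Lap Γ′ ᵀ· z′) b
        ≡⟨ ℤ.+-inverseʳ ((Lap Γ′ ᵀ· z′) b) ⟩
      0ℤ ∎
    sum-e : sumᴳ e ≡ 0ℤ
    sum-e = begin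
      sumᴳ e
        ≡⟨ ∑-distrib-− (λ i → x (L i) - y (L i)) (λ i → (Lap Γ ᵀ· (z′ ∘ π)) (L i)) ⟩
      sum (λ i → x (L i) - y (L i)) - sumᴳ (Lap Γ ᵀ· (z′ ∘ π))
        ≡⟨ cong₂ _-_ (trans (∑-distrib-− (x ∘ L) (y ∘ L)) (ℤ.i≡j⇒i-j≡0 sumᴳx≡sumᴳy))
                     (sumᴳ-Lapᵀ· (z′ ∘ π)) ⟩
      0ℤ - 0ℤ
        ≡⟨⟩
      0ℤ ∎

  sumᴳ-torsion : {y : Fin (n Γ) → ℤ} → IsTorsion Γ y → sumᴳ y ≡ 0ℤ
  sumᴳ-torsion {y} (k , [1+k]y≈0) = ℤ.*-cancelˡ-≡ (+ suc k) (sumᴳ y) 0ℤ (begin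
    + suc k * sumᴳ y            ≡⟨ *-distribˡ-sum (+ suc k) (y ∘ L) ⟩
    sumᴳ (λ u → + suc k * y u)  ≡⟨ sumᴳ-Congruent {λ u → + suc k * y u} {λ _ → 0ℤ} [1+k]y≈0 ⟩
    sumᴳ (λ _ → 0ℤ)             ≡⟨ sumᴳ-0 ⟩
    0ℤ                          ≡⟨ ℤ.*-zeroʳ (+ suc k) ⟨
    + suc k * 0ℤ                ∎)

  torsion-reflect : {y : Fin (n Γ) → ℤ} {y′ : Fin (n Γ′) → ℤ} →
                    (∀ b → push π y b ≡ y′ b) → sumᴳ y ≡ 0ℤ → IsTorsion Γ′ y′ → IsTorsion Γ y
  torsion-reflect {y} push-y sumᴳy≡0 (k , [1+k]y′≈0) = k , Congruent-reflect
    (Congruent-resp Γ′ [1+k]y′≈0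
      (λ b → sym (trans (ᵀ·-*ˡ (χ ∘ π) (+ suc k) y b) (cong (+ suc k *_) (push-y b))))
      (λ b → sym (ᵀ·-0 (χ ∘ π) b)))
    (begin
      sumᴳ (λ u → + suc k * y u)  ≡⟨ *-distribˡ-sum (+ suc k) (y ∘ L) ⟨
      + suc k * sumᴳ y            ≡⟨ cong (+ suc k *_) sumᴳy≡0 ⟩
      + suc k * 0ℤ                ≡⟨ ℤ.*-zeroʳ (+ suc k) ⟩
      0ℤ                          ≡⟨ sumᴳ-0 ⟨
      sumᴳ (λ _ → 0ℤ)             ∎)

  descend : (Fin (n Γ) → ℤ) → Fin (n Γ′) → ℤ
  descend z = (z ∘ L) ++ (λ d → z (R (punchIn w d)) + (z (L v) - z (R w)))

  descend-π : (z : Fin (n Γ) → ℤ) → ∀ x → descend z (π x) ≡ z x + (z (L v) - z (R w)) * 𝟙ᴴ G H x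
  descend-π z = ↑-elim {P = λ x → descend z (π x) ≡ z x + c * 𝟙ᴴ G H x}
    (λ i → begin
      descend z (π (L i))         ≡⟨ cong (descend z) (π-L i) ⟩
      descend z (L′ i)            ≡⟨ lookup-++ˡ (z ∘ L) (λ d → z (R (punchIn w d)) + c) i ⟩
      z (L i)                     ≡⟨ trans (cong (_+_ (z (L i))) (ℤ.*-zeroʳ c)) (ℤ.+-identityʳ _) ⟨
      z (L i) + c * 0ℤ            ≡⟨ cong (λ e → z (L i) + c * e) (𝟙ᴴ-↑ˡ G H i) ⟨
      z (L i) + c * 𝟙ᴴ G H (L i)  ∎)
    (punchIn-elim {P = λ j → descend z (π (R j)) ≡ z (R j) + c * 𝟙ᴴ G H (R j)} w
      (begin
        descend z (π (R w))         ≡⟨ cong (descend z) π-w ⟩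
        descend z (L′ v)            ≡⟨ lookup-++ˡ (z ∘ L) (λ d → z (R (punchIn w d)) + c) v ⟩
        z (L v)                     ≡⟨ shift (z (L v)) (z (R w)) ⟩
        z (R w) + c * 1ℤ            ≡⟨ cong (λ e → z (R w) + c * e) (𝟙ᴴ-↑ʳ G H w) ⟨
        z (R w) + c * 𝟙ᴴ G H (R w)  ∎)
      (λ d → begin
        descend z (π (R (punchIn w d)))  ≡⟨ cong (descend z) (π-R d) ⟩
        descend z (R′ d)                 ≡⟨ lookup-++ʳ (z ∘ L) (λ d → z (R (punchIn w d)) + c) d ⟩
        z (R (punchIn w d)) + c          ≡⟨ cong (_+_ (z (R (punchIn w d)))) (ℤ.*-identityʳ c) ⟨
        z (R (punchIn w d)) + c * 1ℤ     ≡⟨ cong (λ e → z (R (punchIn w d)) + c * e) (𝟙ᴴ-↑ʳ G H (punchIn w d)) ⟨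
        z (R (punchIn w d)) + c * 𝟙ᴴ G H (R (punchIn w d)) ∎))
    where
    c : ℤ
    c = z (L v) - z (R w)
    shift : ∀ a b → a ≡ b + (a - b) * 1ℤ
    shift = solve-∀

  module _ (H-eulerian : Eulerian H) where

    Lapᵀ·-descend : (z : Fin (n Γ) → ℤ) → ∀ u → (Lap Γ ᵀ· z) u ≡ (Lap Γ ᵀ· (descend z ∘ π)) u
    Lapᵀ·-descend z u = sym (begin
      (Lap Γ ᵀ· (descend z ∘ π)) u
        ≡⟨ ᵀ·-cong (Lap Γ) (descend-π z) u ⟩
      (Lap Γ ᵀ· (λ x → z x + c * 𝟙ᴴ G H x)) u
        ≡⟨ ᵀ·-+ (Lap Γ) z (λ x → c * 𝟙ᴴ G H x) u ⟩
      (Lap Γ ᵀ· z) u + (Lap Γ ᵀ· (λ x → c * 𝟙ᴴ G H x)) u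
        ≡⟨ cong (_+_ ((Lap Γ ᵀ· z) u)) (ᵀ·-*ˡ (Lap Γ) c (𝟙ᴴ G H) u) ⟩
      (Lap Γ ᵀ· z) u + c * (Lap Γ ᵀ· 𝟙ᴴ G H) u
        ≡⟨ cong (λ e → (Lap Γ ᵀ· z) u + c * e) (Lapᵀ·-∪-𝟙ᴴ G H H-eulerian u) ⟩
      (Lap Γ ᵀ· z) u + c * 0ℤ
        ≡⟨ trans (cong (_+_ ((Lap Γ ᵀ· z) u)) (ℤ.*-zeroʳ c)) (ℤ.+-identityʳ _) ⟩
      (Lap Γ ᵀ· z) u ∎)
      where
      c : ℤ
      c = z (L v) - z (R w)

    push-Congruent : {x y : Fin (n Γ) → ℤ} → Congruent Γ x y → Congruent Γ′ (push π x) (push π y)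
    push-Congruent {x} {y} (z , x-y≡Qᵀz) = descend z , λ b → begin
      push π x b - push π y b
        ≡⟨ ᵀ·-− (χ ∘ π) x y b ⟨
      push π (λ u → x u - y u) b
        ≡⟨ ᵀ·-cong (χ ∘ π) (λ u → trans (x-y≡Qᵀz u) (trans (Qᵀ≡Lapᵀ· Γ z u) (Lapᵀ·-descend z u))) b ⟩
      push π (Lap Γ ᵀ· (descend z ∘ π)) b
        ≡⟨ Lapᵀ·-quotient Γ π (descend z) b ⟨
      (Lap Γ′ ᵀ· descend z) b
        ≡⟨ Qᵀ≡Lapᵀ· Γ′ (descend z) b ⟨
      Qᵀ Γ′ (descend z) b ∎

    push-torsion : {y : Fin (n Γ) → ℤ} → IsTorsion Γ y → IsTorsion Γ′ (push π y)
    push-torsion {y} (k , [1+k]y≈0) =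
      k , Congruent-resp Γ′ (push-Congruent [1+k]y≈0) (ᵀ·-*ˡ (χ ∘ π) (+ suc k) y) (ᵀ·-0 (χ ∘ π))

    φ : (Fin (n Γ) → ℤ) → (Fin (n Γ′) → ℤ) × ℤ
    φ y = push π y , sumᴳ y

    φ-isGroupIsomorphism : IsGroupIsomorphism (SandpileGroup Γ) (SandpileGroup⊕ℤ Γ′) φ
    φ-isGroupIsomorphism = record
      { isGroupMonomorphism = record
        { isGroupHomomorphism = record
          { isMonoidHomomorphism = record
            { isMagmaHomomorphism = record
              { isRelHomomorphism = record
                { cong = λ {x} {y} x≈y → push-Congruent {x} {y} x≈y , sumᴳ-Congruent {x} {y} x≈y }
              ; homo = λ x y → ≗⇒Congruent Γ′ (ᵀ·-+ (χ ∘ π) x y) , ∑-distrib-+ (x ∘ L) (y ∘ L)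
              }
            ; ε-homo = ≗⇒Congruent Γ′ (ᵀ·-0 (χ ∘ π)) , sumᴳ-0
            }
          ; ⁻¹-homo = λ x → ≗⇒Congruent Γ′ (ᵀ·-neg (χ ∘ π) x) , sym (neg-distrib-sum (x ∘ L))
          }
        ; injective = λ (push≈ , sumᴳ≡) → Congruent-reflect push≈ sumᴳ≡
        }
      ; surjective = λ (y′ , t) → let (y , push-y , sum-y) = push-sumᴳ-surjective y′ t in
          y , λ {z} z≈y → Congruent-resp Γ′ {push π z} (push-Congruent {z} {y} z≈y) (λ _ → refl) push-y ,
                          trans (sumᴳ-Congruent {z} {y} z≈y) sum-y
      }

    φᵗ : Σ _ (IsTorsion Γ) → Σ _ (IsTorsion Γ′)
    φᵗ (y , y-torsion) = push π y , push-torsion y-torsion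

    -- H is written out so that this type is syntactically the one in corollary7p5;
    -- through the abbreviation Γ, Agda unfolds the torsion proofs inside TorsionGroup
    -- when comparing the two, which takes minutes.
    φᵗ-isGroupIsomorphism : IsGroupIsomorphism (TorsionGroup (G ∪ᴳ record { n = suc m ; A = AH }))
                                               (TorsionGroup (identify G (record { n = suc m ; A = AH }) v w)) φᵗ
    φᵗ-isGroupIsomorphism = record
      { isGroupMonomorphism = record
        { isGroupHomomorphism = record
          { isMonoidHomomorphism = record
            { isMagmaHomomorphism = record
              { isRelHomomorphism = record { cong = push-Congruent }
              ; homo = λ (x , _) (y , _) → ≗⇒Congruent Γ′ (ᵀ·-+ (χ ∘ π) x y)
              }
            ; ε-homo = ≗⇒Congruent Γ′ (ᵀ·-0 (χ ∘ π))
            }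
          ; ⁻¹-homo = λ (x , _) → ≗⇒Congruent Γ′ (ᵀ·-neg (χ ∘ π) x)
          }
        ; injective = λ {(x , x-torsion)} {(y , y-torsion)} push≈ →
            Congruent-reflect {x} {y} push≈ (trans (sumᴳ-torsion {x} x-torsion) (sym (sumᴳ-torsion {y} y-torsion)))
        }
      ; surjective = λ (y′ , y′-torsion) → let (y , push-y , sum-y) = push-sumᴳ-surjective y′ 0ℤ in
          (y , torsion-reflect push-y sum-y y′-torsion) ,
          λ {(z , _)} z≈y → Congruent-resp Γ′ {push π z} (push-Congruent {z} {y} z≈y) (λ _ → refl) push-y
      }

corollary7p5 : (G H : Graph) (v : Fin (n G)) (w : Fin (n H)) →
    Balanced G → Balanced H →
    (∃ λ f → IsGroupIsomorphism (SandpileGroup (G ∪ᴳ H)) (SandpileGroup⊕ℤ (identify G H v w)) f)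
    × (∃ λ g → IsGroupIsomorphism (TorsionGroup (G ∪ᴳ H)) (TorsionGroup (identify G H v w)) g)
corollary7p5 G record { n = zero } v () _ _
corollary7p5 G record { n = suc m ; A = AH } v w _ (_ , H-eulerian) =
  (φ H-eulerian , φ-isGroupIsomorphism H-eulerian) , (φᵗ H-eulerian , φᵗ-isGroupIsomorphism H-eulerian)
  where open Identification G AH v w
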